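{- Let $C_n$ denote the cycle on $n\geq 3$ vertices. Then $\chi_\rho''(C_3)=5$; $\chi_\rho''(C_n)=7$ for $n\in\{4,5\}$; $\chi_\rho''(C_6)=8$; $\chi_\rho''(C_n)=9$ for $n\in\{7,8,9,11\}$; $\chi_\rho''(C_n)=10$ for $n\in\{10,12\}$. Moreover, for every $n\geq 13$, $7\leq \chi_\rho''(C_n)\leq 11$.
   Context: All graphs are simple, finite and undirected. The total graph $T(G)$ of a graph $G$ has vertex set $V(G)\cup E(G)$, where two elements are adjacent if they are adjacent vertices of $G$, incident edges of $G$ (sharing an endpoint), or a vertex and an edge of $G$ having that vertex as an endpoint. A packing total coloring of $G$ is a map $c:V(G)\cup E(G)\to\{1,2,\dots\}$ such that for any two distinct elements $A,B\in V(G)\cup E(G)$ with $c(A)=c(B)=i$, the distance between $A$ and $B$ in $T(G)$ is greater than $i$. The packing total chromatic number $\chi_\rho''(G)$ is the smallest $k$ such that $G$ has a packing total coloring with colors from $\{1,\dots,k\}$. -}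

module Defs where

open import Data.Nat using (ℕ; zero; suc; _≤_; _<_; _%_)
open import Data.Nat.Properties using (_≟_)
open import Data.Fin using (Fin; toℕ)
open import Data.Bool using (Bool; T; _∨_)
open import Data.Sum using (_⊎_; inj₁; inj₂)
open import Data.Product using (_×_; Σ-syntax)
open import Relation.Nullary using (¬_)
open import Relation.Nullary.Decidable using (⌊_⌋)
open import Relation.Binary.PropositionalEquality using (_≡_; _≢_)

-- Finite simple graphs on vertex set Fin n.
-- A graph is given by a Boolean relation 'adj'; the (simple, undirected)
-- graph it determines has u ~ v iff u ≢ v and (adj u v or adj v u).

record Graph (n : ℕ) : Set where
  field
    adj : Fin n → Fin n → Bool

module _ {n : ℕ} (G : Graph n) where
  open Graph G

  Adj : Fin n → Fin n → Set
  Adj u v = u ≢ v × T (adj u v ∨ adj v u)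

  -- an edge {u , v} is stored once, with toℕ u < toℕ v
  record Edge : Set where
    constructor edge
    field
      end₁ end₂ : Fin n
      .ordered  : toℕ end₁ < toℕ end₂
      .isEdge   : T (adj end₁ end₂ ∨ adj end₂ end₁)
  open Edge

  -- elements of the total graph T(G): vertices and edges of G
  TElem : Set
  TElem = Fin n ⊎ Edge

  Incident : Fin n → Edge → Set
  Incident u e = u ≡ end₁ e ⊎ u ≡ end₂ e

  SameEdge : Edge → Edge → Set
  SameEdge e f = end₁ e ≡ end₁ f × end₂ e ≡ end₂ f

  ShareEnd : Edge → Edge → Set
  ShareEnd e f = Incident (end₁ e) f ⊎ Incident (end₂ e) f

  TAdj : TElem → TElem → Set
  TAdj (inj₁ u) (inj₁ v) = Adj u v
  TAdj (inj₁ u) (inj₂ e) = Incident u e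
  TAdj (inj₂ e) (inj₁ u) = Incident u e
  TAdj (inj₂ e) (inj₂ f) = ¬ SameEdge e f × ShareEnd e f

  data TWalk : TElem → TElem → ℕ → Set where
    here : ∀ {A} → TWalk A A 0
    step : ∀ {A C B m} → TAdj A C → TWalk C B m → TWalk A B (suc m)

  -- d_{T(G)}(A , B) > i  (no walk, hence no path, of length ≤ i;
  -- includes the case of infinite distance)
  DistGreater : TElem → TElem → ℕ → Set
  DistGreater A B i = ∀ m → m ≤ i → ¬ TWalk A B m

  record PackingTotalColoring (k : ℕ) : Set where
    field
      col     : TElem → ℕ
      col≥1   : ∀ A → 1 ≤ col A
      col≤k   : ∀ A → col A ≤ k
      packing : ∀ A B → A ≢ B → col A ≡ col B → DistGreater A B (col A)

  PackingTotalChromaticNumber : ℕ → Set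
  PackingTotalChromaticNumber k =
    PackingTotalColoring k × (∀ j → PackingTotalColoring j → k ≤ j)

-- (defined by cases on n only so that the modulus is visibly nonzero;
-- Fin 0 is empty, so the zero case is vacuous)
cycleAdj : (n : ℕ) → Fin n → Fin n → Bool
cycleAdj zero    () _
cycleAdj (suc m) i  j = ⌊ (suc (toℕ i) % suc m) ≟ toℕ j ⌋

Cycle : (n : ℕ) → Graph n
Cycle n = record { adj = cycleAdj n }

-- Listing the elements of T(C_n) around the cycle as v₀, e₀, v₁, e₁, …, two of them are adjacent
-- exactly when they are at most two places apart: T(C_n) is the square of the cycle C_{2n}. So a
-- walk of length ℓ moves at most 2ℓ places, and d places are covered by a walk of length ⌈d/2⌉;
-- packing total colourings of C_n are the colourings of ℤ/2n in which two places of colour c are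
-- more than 2c apart. Upper bounds are explicit such colourings; for n ≥ 13 a word of length 24
-- can be repeated, so one base word per residue of n modulo 12 suffices. Lower bounds count:
-- colour c occurs at most max(1, ⌊2n/(2c+1)⌋) times, too few for 2n places with one colour less
-- than claimed, and for n ≥ 13 six colours always fail since Σ_{c=1}^{6} 1/(2c+1) < 1. As
-- colourability with j colours is decidable, a least number of colours exists.

module Submission where

open import Defs
open import Data.Nat
open import Data.Nat.Properties
open import Data.Nat.DivMod
  using (_%_; _/_; m%n<n; m<n⇒m%n≡m; m≡m%n+[m/n]*n; m*n/n≡m; /-monoˡ-≤)
open import Data.Nat.GeneralisedArithmetic using (fold)
open import Data.Nat.Induction using (<-rec)
open import Data.Nat.Tactic.RingSolver using (solve-∀)
open import Data.Fin using (Fin; toℕ; fromℕ<)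
open import Data.Fin.Properties using (toℕ-fromℕ<; toℕ-injective; toℕ<n)
open import Data.Bool using (true; false; T; T?; _∨_; if_then_else_)
open import Data.Bool.Properties using (T-∨)
open import Data.List using (List; []; _∷_; _++_; length; take; drop; applyUpTo)
open import Data.List.Properties
  using (length-++; length-++-≤ˡ; length-++-≤ʳ; length-take; length-drop; length-applyUpTo; ++-assoc)
open import Data.List.Relation.Unary.All as All using (All; []; _∷_; all?)
open import Data.List.Relation.Unary.All.Properties using (++⁺)
open import Data.Product using (∃; Σ-syntax; _×_; _,_; proj₁; proj₂)
open import Data.Sum using (_⊎_; inj₁; inj₂; [_,_])
open import Data.Empty using (⊥; ⊥-elim)
open import Function using (_∘_; Equivalence)
open import Relation.Nullary using (¬_; Dec; yes; no; ¬?)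
open import Relation.Nullary.Decidable using (True; toWitness; fromWitness; recompute; map′; _×-dec_; _→-dec_)
open import Relation.Binary using (tri<; tri≈; tri>)
open import Relation.Binary.PropositionalEquality hiding ([_])

-- Congruences and distances on ℤ/N

infix 4 _≋_mod_

record _≋_mod_ (x y N : ℕ) : Set where
  constructor congruent
  field
    k l : ℕ
    shifted : x + k * N ≡ y + l * N

module _ {N : ℕ} where

  ≡⇒≋ : ∀ {x y} → x ≡ y → x ≋ y mod N
  ≡⇒≋ refl = congruent 0 0 refl

  ≋-period : ∀ x → N + x ≋ x mod N
  ≋-period x = congruent 0 1 (shift N x)
    where
    shift : ∀ n y → n + y + 0 * n ≡ y + 1 * n
    shift = solve-∀

  ≋-sym : ∀ {x y} → x ≋ y mod N → y ≋ x mod N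
  ≋-sym (congruent k l e) = congruent l k (sym e)

  ≋-trans : ∀ {x y z} → x ≋ y mod N → y ≋ z mod N → x ≋ z mod N
  ≋-trans {x} {y} {z} (congruent k l e) (congruent k′ l′ e′) = congruent (k + k′) (l′ + l) (begin
    x + (k + k′) * N       ≡⟨ shuffle x k k′ N ⟩
    (x + k * N) + k′ * N   ≡⟨ cong (_+ k′ * N) e ⟩
    (y + l * N) + k′ * N   ≡⟨ exchange y l k′ N ⟩
    (y + k′ * N) + l * N   ≡⟨ cong (_+ l * N) e′ ⟩
    (z + l′ * N) + l * N   ≡⟨ shuffle z l′ l N ⟨
    z + (l′ + l) * N       ∎)
    where
    open ≡-Reasoning
    shuffle : ∀ a b c n → a + (b + c) * n ≡ (a + b * n) + c * n
    shuffle = solve-∀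
    exchange : ∀ a b c n → (a + b * n) + c * n ≡ (a + c * n) + b * n
    exchange = solve-∀

  private
    swap-+ : ∀ x d k n → (x + d) + k * n ≡ (x + k * n) + d
    swap-+ = solve-∀

  ≋-+ʳ : ∀ {x y} d → x ≋ y mod N → x + d ≋ y + d mod N
  ≋-+ʳ {x} {y} d (congruent k l e) = congruent k l (begin
    (x + d) + k * N ≡⟨ swap-+ x d k N ⟩
    (x + k * N) + d ≡⟨ cong (_+ d) e ⟩
    (y + l * N) + d ≡⟨ swap-+ y d l N ⟨
    (y + d) + l * N ∎)
    where open ≡-Reasoning

  ≋-+ʳ-cancel : ∀ {x y} d → x + d ≋ y + d mod N → x ≋ y mod N
  ≋-+ʳ-cancel {x} {y} d (congruent k l e) = congruent k l (+-cancelʳ-≡ d _ _ (begin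
    (x + k * N) + d ≡⟨ swap-+ x d k N ⟨
    (x + d) + k * N ≡⟨ e ⟩
    (y + d) + l * N ≡⟨ swap-+ y d l N ⟩
    (y + l * N) + d ∎))
    where open ≡-Reasoning

  ≋-suc : ∀ {x y} → x ≋ y mod N → suc x ≋ suc y mod N
  ≋-suc {x} {y} c =
    ≋-trans (≡⇒≋ (+-comm 1 x)) (≋-trans (≋-+ʳ 1 c) (≡⇒≋ (+-comm y 1)))

  ≋-residue : ∀ {x y} → x ≋ y mod N → y < N → ∃ λ t → x ≡ y + t * N
  ≋-residue {x} {y} (congruent k l e) y<N with ≤-total k l
  ... | inj₁ k≤l with m≤n⇒∃[o]m+o≡n k≤l
  ...   | t , refl = t , +-cancelʳ-≡ (k * N) _ _ (trans e (split y k t N))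
    where
    split : ∀ a b c n → a + (b + c) * n ≡ (a + c * n) + b * n
    split = solve-∀
  ≋-residue {x} {y} (congruent k l e) y<N | inj₂ l≤k with m≤n⇒∃[o]m+o≡n l≤k
  ... | zero , refl = 0 , +-cancelʳ-≡ (l * N) _ _ (trans (pad₁ x l N) (trans e (pad₂ y l N)))
    where
    pad₁ : ∀ a b n → a + b * n ≡ a + (b + 0) * n
    pad₁ = solve-∀
    pad₂ : ∀ a b n → a + b * n ≡ (a + 0 * n) + b * n
    pad₂ = solve-∀
  ... | suc s , refl = ⊥-elim (<⇒≱ y<N (begin
    N                    ≤⟨ m≤n+m N (x + s * N) ⟩
    x + s * N + N        ≡⟨ +-cancelʳ-≡ (l * N) _ _ (trans (split x s N l) e) ⟩
    y                    ∎))
    where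
    open ≤-Reasoning
    split : ∀ a b n c → a + b * n + n + c * n ≡ a + (c + suc b) * n
    split = solve-∀

  ≋-% : .{{_ : NonZero N}} → ∀ x → x ≋ x % N mod N
  ≋-% x = congruent 0 (x / N) (trans (+-identityʳ x) (m≡m%n+[m/n]*n x N))

  ≋-residues⇒≡ : ∀ {x y} → x ≋ y mod N → x < N → y < N → x ≡ y
  ≋-residues⇒≡ {x} {y} xy x<N y<N with ≋-residue xy y<N
  ... | zero , eq = trans eq (+-identityʳ y)
  ... | suc t , eq = ⊥-elim (<⇒≱ x<N (subst (N ≤_) (sym eq) (≤-trans (m≤m+n N (t * N)) (m≤n+m _ y))))

  ¬≋-shift : ∀ x {d} → 0 < d → d < N → ¬ (d + x ≋ x mod N)
  ¬≋-shift x {d} 0<d d<N shift =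
    <⇒≢ 0<d (sym (≋-residues⇒≡ (≋-+ʳ-cancel x shift) d<N (≤-trans 0<d (<⇒≤ d<N))))

≋-*ˡ : ∀ c {N x y} → x ≋ y mod N → c * x ≋ c * y mod (c * N)
≋-*ˡ c {N} {x} {y} (congruent k l e) = congruent k l (begin
  c * x + k * (c * N)   ≡⟨ scale c x k N ⟩
  c * (x + k * N)       ≡⟨ cong (c *_) e ⟩
  c * (y + l * N)       ≡⟨ scale c y l N ⟨
  c * y + l * (c * N)   ∎)
  where
  open ≡-Reasoning
  scale : ∀ a b d n → a * b + d * (a * n) ≡ a * (b + d * n)
  scale = solve-∀

record Within (N r a b : ℕ) : Set where
  constructor within
  field
    offset  : ℕ
    offset≤ : offset ≤ r
    reaches : a + offset ≋ b mod N ⊎ b + offset ≋ a mod N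

module _ {N : ℕ} where

  within-refl : ∀ a → Within N 0 a a
  within-refl a = within 0 z≤n (inj₁ (≡⇒≋ (+-identityʳ a)))

  within-sym : ∀ {r a b} → Within N r a b → Within N r b a
  within-sym (within d d≤r (inj₁ ab)) = within d d≤r (inj₂ ab)
  within-sym (within d d≤r (inj₂ ba)) = within d d≤r (inj₁ ba)

  private
    split-≤ : ∀ d₁ d₂ → (∃ λ e → d₁ ≡ d₂ + e) ⊎ (∃ λ e → d₂ ≡ d₁ + e)
    split-≤ d₁ d₂ with ≤-total d₂ d₁
    ... | inj₁ d₂≤d₁ = let e , eq = m≤n⇒∃[o]m+o≡n d₂≤d₁ in inj₁ (e , sym eq)
    ... | inj₂ d₁≤d₂ = let e , eq = m≤n⇒∃[o]m+o≡n d₁≤d₂ in inj₂ (e , sym eq)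

    chain : ∀ {a b c} d₁ d₂ → a + d₁ ≋ b mod N → b + d₂ ≋ c mod N → a + (d₁ + d₂) ≋ c mod N
    chain {a} d₁ d₂ ab bc = ≋-trans (≡⇒≋ (sym (+-assoc a d₁ d₂))) (≋-trans (≋-+ʳ d₂ ab) bc)

    difference : ∀ {a c} d e → a + (d + e) ≋ c + d mod N → a + e ≋ c mod N
    difference {a} {c} d e ac = ≋-+ʳ-cancel d (≋-trans (≡⇒≋ (shuffle a e d)) ac)
      where
      shuffle : ∀ x y z → (x + y) + z ≡ x + (z + y)
      shuffle = solve-∀

    common-target : ∀ {r s a b c} d₁ d₂ → d₁ ≤ r → d₂ ≤ s →
                    a + d₁ ≋ b mod N → c + d₂ ≋ b mod N → Within N (r + s) a c
    common-target {r} {s} {a} {c = c} d₁ d₂ d₁≤r d₂≤s ab cb with split-≤ d₁ d₂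
    ... | inj₁ (e , refl) = within e (≤-trans (m≤n+m e d₂) (≤-trans d₁≤r (m≤m+n r s)))
                              (inj₁ (difference d₂ e (≋-trans ab (≋-sym cb))))
    ... | inj₂ (e , refl) = within e (≤-trans (m≤n+m e d₁) (≤-trans d₂≤s (m≤n+m s r)))
                              (inj₂ (difference d₁ e (≋-trans cb (≋-sym ab))))

    common-source : ∀ {r s a b c} d₁ d₂ → d₁ ≤ r → d₂ ≤ s →
                    b + d₁ ≋ a mod N → b + d₂ ≋ c mod N → Within N (r + s) a c
    common-source {r} {s} {b = b} d₁ d₂ d₁≤r d₂≤s ba bc with split-≤ d₁ d₂
    ... | inj₁ (e , refl) = within e (≤-trans (m≤n+m e d₂) (≤-trans d₁≤r (m≤m+n r s)))
      (inj₂ (≋-trans (≋-+ʳ e (≋-sym bc)) (≋-trans (≡⇒≋ (+-assoc b d₂ e)) ba)))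
    ... | inj₂ (e , refl) = within e (≤-trans (m≤n+m e d₁) (≤-trans d₂≤s (m≤n+m s r)))
      (inj₁ (≋-trans (≋-+ʳ e (≋-sym ba)) (≋-trans (≡⇒≋ (+-assoc b d₁ e)) bc)))

  within-trans : ∀ {r s a b c} → Within N r a b → Within N s b c → Within N (r + s) a c
  within-trans (within d₁ d₁≤r (inj₁ ab)) (within d₂ d₂≤s (inj₁ bc)) =
    within (d₁ + d₂) (+-mono-≤ d₁≤r d₂≤s) (inj₁ (chain d₁ d₂ ab bc))
  within-trans (within d₁ d₁≤r (inj₁ ab)) (within d₂ d₂≤s (inj₂ cb)) =
    common-target d₁ d₂ d₁≤r d₂≤s ab cb
  within-trans (within d₁ d₁≤r (inj₂ ba)) (within d₂ d₂≤s (inj₁ bc)) =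
    common-source d₁ d₂ d₁≤r d₂≤s ba bc
  within-trans {r} {s} (within d₁ d₁≤r (inj₂ ba)) (within d₂ d₂≤s (inj₂ cb)) =
    within (d₂ + d₁) (subst (d₂ + d₁ ≤_) (+-comm s r) (+-mono-≤ d₂≤s d₁≤r))
      (inj₂ (chain d₂ d₁ cb ba))

  -- for residues a < b the two arcs between them have lengths b ∸ a and N + a ∸ b
  within-residues : ∀ {r a b} → Within N r a b → a < b → b < N → b ≤ a + r ⊎ N + a ≤ b + r
  within-residues {r} {a} {b} (within d d≤r (inj₁ ab)) a<b b<N with ≋-residue ab b<N
  ... | zero , eq = inj₁ (begin
    b          ≡⟨ +-identityʳ b ⟨
    b + 0      ≡⟨ eq ⟨
    a + d      ≤⟨ +-monoʳ-≤ a d≤r ⟩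
    a + r      ∎)
    where open ≤-Reasoning
  ... | suc t , eq = inj₂ (begin
    N + a          ≤⟨ +-monoʳ-≤ N (<⇒≤ a<b) ⟩
    N + b          ≡⟨ +-comm N b ⟩
    b + N          ≤⟨ +-monoʳ-≤ b (m≤m+n N (t * N)) ⟩
    b + suc t * N  ≡⟨ eq ⟨
    a + d          ≤⟨ +-mono-≤ (<⇒≤ a<b) d≤r ⟩
    b + r          ∎)
    where open ≤-Reasoning
  within-residues {r} {a} {b} (within d d≤r (inj₂ ba)) a<b b<N with ≋-residue ba (<-trans a<b b<N)
  ... | zero , eq = ⊥-elim (<⇒≱ a<b (begin
    b          ≤⟨ m≤m+n b d ⟩
    b + d      ≡⟨ eq ⟩
    a + 0      ≡⟨ +-identityʳ a ⟩
    a          ∎))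
    where open ≤-Reasoning
  ... | suc t , eq = inj₂ (begin
    N + a          ≡⟨ +-comm N a ⟩
    a + N          ≤⟨ +-monoʳ-≤ a (m≤m+n N (t * N)) ⟩
    a + suc t * N  ≡⟨ eq ⟨
    b + d          ≤⟨ +-monoʳ-≤ b d≤r ⟩
    b + r          ∎)
    where open ≤-Reasoning

  within-weaken : ∀ {r s a b} → r ≤ s → Within N r a b → Within N s a b
  within-weaken r≤s (within d d≤r reach) = within d (≤-trans d≤r r≤s) reach

-- Packing colourings of the square of a cycle

-- A packing colouring of the square of the cycle C_N on positions 0 … N-1: two positions of
-- colour c are more than 2c apart both ways round, i.e. at distance more than c in C_N².
SquarePacking : ℕ → (ℕ → ℕ) → Set
SquarePacking N f = ∀ {q} → q < N → ∀ {p} → p < q → f p ≡ f q → p + 2 * f p < q × q + 2 * f p < N + p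

InRange : ℕ → ℕ → Set
InRange k c = 1 ≤ c × c ≤ k

record SquarePackingColouring (N k : ℕ) : Set where
  field
    colour  : ℕ → ℕ
    inRange : ∀ {p} → p < N → InRange k (colour p)
    packing : SquarePacking N colour

module _ {N : ℕ} where

  gaps⇒far : ∀ {a b c r} → b < N → a < b → a + 2 * c < b → b + 2 * c < N + a →
             Within N r a b → 2 * c < r
  gaps⇒far {a} {b} {c} {r} b<N a<b gap₁ gap₂ w = ≰⇒> λ r≤2c →
    [ (λ b≤a+r → <⇒≱ gap₁ (≤-trans b≤a+r (+-monoʳ-≤ a r≤2c)))
    , (λ N+a≤b+r → <⇒≱ gap₂ (≤-trans N+a≤b+r (+-monoʳ-≤ b r≤2c)))
    ] (within-residues w a<b b<N)

  squarePacking-far : ∀ {f p q r} → SquarePacking N f → p < N → q < N → p ≢ q → f p ≡ f q →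
                      Within N r p q → 2 * f p < r
  squarePacking-far {f} {p} {q} packing p<N q<N p≢q same w with <-cmp p q
  ... | tri< p<q _ _ = let gap₁ , gap₂ = packing q<N p<q same in gaps⇒far {c = f p} q<N p<q gap₁ gap₂ w
  ... | tri≈ _ p≡q _ = ⊥-elim (p≢q p≡q)
  ... | tri> _ _ q<p = let gap₁ , gap₂ = packing p<N q<p (sym same) in
    subst (λ c → 2 * c < _) (sym same) (gaps⇒far {c = f q} p<N q<p gap₁ gap₂ (within-sym w))

-- The counting bound

occurrences : (ℕ → ℕ) → ℕ → ℕ → ℕ
occurrences f c zero = 0
occurrences f c (suc b) with f b ≟ c
... | yes _ = suc (occurrences f c b)
... | no  _ = occurrences f c b

occurrences-hit : ∀ f {c} b → f b ≡ c → occurrences f c (suc b) ≡ suc (occurrences f c b)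
occurrences-hit f {c} b fb≡c with f b ≟ c
... | yes _    = refl
... | no fb≢c = ⊥-elim (fb≢c fb≡c)

occurrences-miss : ∀ f {c} b → f b ≢ c → occurrences f c (suc b) ≡ occurrences f c b
occurrences-miss f {c} b fb≢c with f b ≟ c
... | yes fb≡c = ⊥-elim (fb≢c fb≡c)
... | no _     = refl

module _ {N f} (packing : SquarePacking N f) (c : ℕ) where

  record Spread (b : ℕ) : Set where
    field
      first last gaps : ℕ
      count      : occurrences f c b ≡ suc gaps
      first≤last : first ≤ last
      last<b     : last < b
      first-c    : f first ≡ c
      last-c     : f last ≡ c
      separation : gaps * suc (2 * c) + first ≤ last

  private
    one-more-gap : ∀ {gaps first last} → gaps * suc (2 * c) + first ≤ last →
                   suc gaps * suc (2 * c) + first ≤ suc (last + 2 * c)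
    one-more-gap {gaps} {first} {last} separation = begin
      suc gaps * suc (2 * c) + first               ≡⟨ +-assoc (suc (2 * c)) (gaps * suc (2 * c)) first ⟩
      suc (2 * c) + (gaps * suc (2 * c) + first)   ≤⟨ +-monoʳ-≤ (suc (2 * c)) separation ⟩
      suc (2 * c + last)                           ≡⟨ cong suc (+-comm (2 * c) last) ⟩
      suc (last + 2 * c)                           ∎
      where open ≤-Reasoning

  spread : ∀ b → b ≤ N → occurrences f c b ≡ 0 ⊎ Spread b
  spread zero    _     = inj₁ refl
  spread (suc b) b<N = extend (f b ≟ c) (spread b (<⇒≤ b<N))
    where
    extend : Dec (f b ≡ c) → occurrences f c b ≡ 0 ⊎ Spread b →
             occurrences f c (suc b) ≡ 0 ⊎ Spread (suc b)
    extend (yes fb≡c) (inj₁ none) = inj₂ (record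
      { first = b ; last = b ; gaps = 0 ; count = trans (occurrences-hit f b fb≡c) (cong suc none)
      ; first≤last = ≤-refl ; last<b = ≤-refl ; first-c = fb≡c ; last-c = fb≡c ; separation = ≤-refl })
    extend (yes fb≡c) (inj₂ s) = inj₂ (record
      { first = first ; last = b ; gaps = suc gaps ; count = trans (occurrences-hit f b fb≡c) (cong suc count)
      ; first≤last = ≤-trans first≤last (<⇒≤ last<b) ; last<b = ≤-refl
      ; first-c = first-c ; last-c = fb≡c ; separation = further })
      where
      open Spread s
      further : suc gaps * suc (2 * c) + first ≤ b
      further = ≤-trans (one-more-gap {gaps} separation)
        (subst (λ x → suc (last + 2 * x) ≤ b) last-c (proj₁ (packing b<N last<b (trans last-c (sym fb≡c)))))
    extend (no fb≢c) (inj₁ none) = inj₁ (trans (occurrences-miss f b fb≢c) none)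
    extend (no fb≢c) (inj₂ s) = inj₂ (record
      { first = first ; last = last ; gaps = gaps ; count = trans (occurrences-miss f b fb≢c) count
      ; first≤last = first≤last ; last<b = ≤-trans last<b (n≤1+n b)
      ; first-c = first-c ; last-c = last-c ; separation = separation })
      where open Spread s

  -- the gap from the last occurrence round to the first one adds the last 2c+1
  occurrences-bound : occurrences f c N ≤ 1 ⊎ occurrences f c N * suc (2 * c) ≤ N
  occurrences-bound with spread N ≤-refl
  ... | inj₁ none = inj₁ (≤-trans (≤-reflexive none) z≤n)
  ... | inj₂ s with m≤n⇒m<n∨m≡n (Spread.first≤last s)
  ...   | inj₂ refl = inj₁ (≤-reflexive (trans count (cong suc gaps≡0)))
    where
    open Spread s
    gaps≡0 : gaps ≡ 0
    gaps≡0 = n≤0⇒n≡0 (≤-trans (m≤m*n gaps (suc (2 * c))) (+-cancelʳ-≤ first _ 0 separation))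
  ...   | inj₁ first<last =
    inj₂ (subst (_≤ N) (cong (_* suc (2 * c)) (sym count)) (+-cancelʳ-≤ first _ _ wraps))
    where
    open Spread s
    wraps : suc gaps * suc (2 * c) + first ≤ N + first
    wraps = ≤-trans (one-more-gap {gaps} separation)
      (subst (λ x → suc (last + 2 * x) ≤ N + first) first-c
        (proj₂ (packing last<b first<last (trans first-c (sym last-c)))))

colourCount : (ℕ → ℕ) → ℕ → ℕ → ℕ
colourCount f zero    b = 0
colourCount f (suc k) b = occurrences f (suc k) b + colourCount f k b

colourCount-above : ∀ f k b → k < f b → colourCount f k (suc b) ≡ colourCount f k b
colourCount-above f zero    b _   = refl
colourCount-above f (suc k) b k<fb = cong₂ _+_
  (occurrences-miss f b (λ fb≡k → <-irrefl (sym fb≡k) k<fb)) (colourCount-above f k b (<-trans (n<1+n k) k<fb))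

colourCount-inRange : ∀ f k b → InRange k (f b) → colourCount f k (suc b) ≡ suc (colourCount f k b)
colourCount-inRange f zero    b (1≤fb , fb≤0) = ⊥-elim (<⇒≱ 1≤fb fb≤0)
colourCount-inRange f (suc k) b (1≤fb , fb≤k) = by-cases (f b ≟ suc k)
  where
  by-cases : Dec (f b ≡ suc k) → colourCount f (suc k) (suc b) ≡ suc (colourCount f (suc k) b)
  by-cases (yes fb≡k) =
    cong₂ _+_ (occurrences-hit f b fb≡k) (colourCount-above f k b (≤-reflexive (sym fb≡k)))
  by-cases (no fb≢k)  = trans
    (cong₂ _+_ (occurrences-miss f b fb≢k)
               (colourCount-inRange f k b (1≤fb , s≤s⁻¹ (≤∧≢⇒< fb≤k fb≢k))))
    (+-suc (occurrences f (suc k) b) (colourCount f k b))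

colourCount-all : ∀ {N f k} → (∀ {p} → p < N → InRange k (f p)) →
                  ∀ b → b ≤ N → colourCount f k b ≡ b
colourCount-all {f = f} {k} _ zero _ = zero-count k
  where
  zero-count : ∀ k → colourCount f k 0 ≡ 0
  zero-count zero    = refl
  zero-count (suc k) = zero-count k
colourCount-all {f = f} {k} inRange (suc b) b<N =
  trans (colourCount-inRange f k b (inRange b<N)) (cong suc (colourCount-all inRange b (<⇒≤ b<N)))

capacity : ℕ → ℕ → ℕ
capacity N zero    = 0
capacity N (suc k) = (1 ⊔ N / suc (2 * suc k)) + capacity N k

module _ {N k} (χ : SquarePackingColouring N k) where
  open SquarePackingColouring χ

  occurrences≤capacity : ∀ c → occurrences colour c N ≤ 1 ⊔ N / suc (2 * c)
  occurrences≤capacity c with occurrences-bound packing c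
  ... | inj₁ ≤1 = ≤-trans ≤1 (m≤m⊔n 1 (N / suc (2 * c)))
  ... | inj₂ ≤N = ≤-trans (≤-trans (≤-reflexive (sym (m*n/n≡m _ (suc (2 * c)))))
                                   (/-monoˡ-≤ (suc (2 * c)) ≤N))
                          (m≤n⊔m 1 (N / suc (2 * c)))

  N≤capacity : N ≤ capacity N k
  N≤capacity = subst (_≤ capacity N k) (colourCount-all inRange N ≤-refl) (bound k)
    where
    bound : ∀ j → colourCount colour j N ≤ capacity N j
    bound zero    = z≤n
    bound (suc j) = +-mono-≤ (occurrences≤capacity (suc j)) (bound j)

  occurrences-spaced : ∀ c → suc (2 * c) ≤ N → occurrences colour c N * suc (2 * c) ≤ N
  occurrences-spaced c g≤N with occurrences-bound packing c
  ... | inj₁ ≤1 = ≤-trans (*-monoˡ-≤ (suc (2 * c)) ≤1) (≤-trans (≤-reflexive (*-identityˡ _)) g≤N)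
  ... | inj₂ ≤N = ≤N

-- Σ_{c=1}^{6} 1/(2c+1) < 1, cleared of denominators by 45045 = lcm(3, 5, …, 13)
private
  six-fractions : ∀ N a b c d e h → 1 ≤ N →
                  a * 3 ≤ N → b * 5 ≤ N → c * 7 ≤ N → d * 9 ≤ N → e * 11 ≤ N → h * 13 ≤ N →
                  h + (e + (d + (c + (b + (a + 0))))) < N
  six-fractions N a b c d e h 1≤N a3 b5 c7 d9 e11 h13 = *-cancelˡ-< 45045 _ _ (begin-strict
    45045 * (h + (e + (d + (c + (b + (a + 0))))))
      ≡⟨ clear a b c d e h ⟩
    15015 * (a * 3) + 9009 * (b * 5) + 6435 * (c * 7) + 5005 * (d * 9) + 4095 * (e * 11) + 3465 * (h * 13)
      ≤⟨ +-mono-≤ (+-mono-≤ (+-mono-≤ (+-mono-≤ (+-mono-≤ (*-monoʳ-≤ 15015 a3) (*-monoʳ-≤ 9009 b5))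
                   (*-monoʳ-≤ 6435 c7)) (*-monoʳ-≤ 5005 d9)) (*-monoʳ-≤ 4095 e11)) (*-monoʳ-≤ 3465 h13) ⟩
    15015 * N + 9009 * N + 6435 * N + 5005 * N + 4095 * N + 3465 * N
      ≡⟨ sum N ⟩
    43024 * N + 0
      <⟨ +-monoʳ-< (43024 * N) (*-monoʳ-< 2021 1≤N) ⟩
    43024 * N + 2021 * N
      ≡⟨ split N ⟨
    45045 * N ∎)
    where
    open ≤-Reasoning
    clear : ∀ a b c d e h → 45045 * (h + (e + (d + (c + (b + (a + 0)))))) ≡
            15015 * (a * 3) + 9009 * (b * 5) + 6435 * (c * 7) + 5005 * (d * 9) + 4095 * (e * 11) + 3465 * (h * 13)
    clear = solve-∀
    sum : ∀ N → 15015 * N + 9009 * N + 6435 * N + 5005 * N + 4095 * N + 3465 * N ≡ 43024 * N + 0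
    sum = solve-∀
    split : ∀ N → 45045 * N ≡ 43024 * N + 2021 * N
    split = solve-∀

no-six-colouring : ∀ {N} → 13 ≤ N → ¬ SquarePackingColouring N 6
no-six-colouring {N} 13≤N χ = <-irrefl (colourCount-all inRange N ≤-refl)
  (six-fractions N (uses 1) (uses 2) (uses 3) (uses 4) (uses 5) (uses 6) (≤-trans (s≤s z≤n) 13≤N)
    (spaced 1 (m≤m+n 3 10)) (spaced 2 (m≤m+n 5 8)) (spaced 3 (m≤m+n 7 6))
    (spaced 4 (m≤m+n 9 4)) (spaced 5 (m≤m+n 11 2)) (spaced 6 ≤-refl))
  where
  open SquarePackingColouring χ
  uses : ℕ → ℕ
  uses c = occurrences colour c N
  spaced : ∀ c → suc (2 * c) ≤ 13 → occurrences colour c N * suc (2 * c) ≤ N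
  spaced c g≤13 = occurrences-spaced χ c (≤-trans g≤13 13≤N)

colouring-weaken : ∀ {N j k} → j ≤ k → SquarePackingColouring N j → SquarePackingColouring N k
colouring-weaken j≤k χ = record
  { colour  = colour
  ; inRange = λ p<N → let 1≤ , ≤j = inRange p<N in 1≤ , ≤-trans ≤j j≤k
  ; packing = packing
  }
  where open SquarePackingColouring χ

capacity-exceeded : ∀ {N k} → capacity N k < N → ∀ {j} → j ≤ k → ¬ SquarePackingColouring N j
capacity-exceeded {N} {k} cap<N j≤k χ = <⇒≱ cap<N (N≤capacity (colouring-weaken j≤k χ))

-- Colourings as cyclic words

module _ {A : Set} where

  take-++ˡ : ∀ k (xs ys : List A) → k ≤ length xs → take k (xs ++ ys) ≡ take k xs
  take-++ˡ zero    xs       ys _         = refl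
  take-++ˡ (suc k) (x ∷ xs) ys (s≤s k≤) = cong (x ∷_) (take-++ˡ k xs ys k≤)

  take-++ʳ : ∀ (xs ys : List A) k → take (length xs + k) (xs ++ ys) ≡ xs ++ take k ys
  take-++ʳ []       ys k = refl
  take-++ʳ (x ∷ xs) ys k = cong (x ∷_) (take-++ʳ xs ys k)

  drop-++ˡ : ∀ k (xs ys : List A) → k ≤ length xs → drop k (xs ++ ys) ≡ drop k xs ++ ys
  drop-++ˡ zero    xs       ys _         = refl
  drop-++ˡ (suc k) (x ∷ xs) ys (s≤s k≤) = drop-++ˡ k xs ys k≤

  drop-++ʳ : ∀ (xs ys : List A) k → drop (length xs + k) (xs ++ ys) ≡ drop k ys
  drop-++ʳ []       ys k = refl
  drop-++ʳ (x ∷ xs) ys k = drop-++ʳ xs ys k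

-- indexing with junk value 0 past the end
nth : List ℕ → ℕ → ℕ
nth []       _       = 0
nth (x ∷ xs) zero    = x
nth (x ∷ xs) (suc i) = nth xs i

nth-++ˡ : ∀ xs ys {i} → i < length xs → nth (xs ++ ys) i ≡ nth xs i
nth-++ˡ (x ∷ xs) ys {zero}  _          = refl
nth-++ˡ (x ∷ xs) ys {suc i} (s≤s i<)   = nth-++ˡ xs ys i<

nth-++ʳ : ∀ xs ys i → nth (xs ++ ys) (length xs + i) ≡ nth ys i
nth-++ʳ []       ys i = refl
nth-++ʳ (x ∷ xs) ys i = nth-++ʳ xs ys i

nth-drop : ∀ k xs i → nth (drop k xs) i ≡ nth xs (k + i)
nth-drop zero    xs       i = refl
nth-drop (suc k) []       i = refl
nth-drop (suc k) (x ∷ xs) i = nth-drop k xs i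

nth-take : ∀ k xs {i} → i < k → nth (take k xs) i ≡ nth xs i
nth-take (suc k) []       {i}     _        = refl
nth-take (suc k) (x ∷ xs) {zero}  _        = refl
nth-take (suc k) (x ∷ xs) {suc i} (s≤s i<) = nth-take k xs i<

All-nth : ∀ {P : ℕ → Set} {xs} → All P xs → ∀ {i} → i < length xs → P (nth xs i)
All-nth (px ∷ _)   {zero}  _        = px
All-nth (_  ∷ pxs) {suc i} (s≤s i<) = All-nth pxs i<

All-take-nth : ∀ {P : ℕ → Set} k xs → All P (take k xs) → ∀ {i} → i < k → i < length xs → P (nth xs i)
All-take-nth (suc k) (x ∷ xs) (px ∷ _)   {zero}  _        _         = px
All-take-nth (suc k) (x ∷ xs) (_  ∷ pxs) {suc i} (s≤s i<) (s≤s i<′) = All-take-nth k xs pxs i< i<′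

rotation : List ℕ → ℕ → List ℕ
rotation w i = drop (suc i) w ++ take i w

PackedAt : List ℕ → ℕ → Set
PackedAt w i = All (_≢ nth w i) (take (2 * nth w i) (rotation w i))

Packed : List ℕ → Set
Packed w = ∀ {i} → i < length w → PackedAt w i

length-split : ∀ k (xs : List ℕ) → k ≤ length xs → length xs ≡ k + length (drop k xs)
length-split k xs k≤ = trans (sym (m+[n∸m]≡n k≤)) (cong (k +_) (sym (length-drop k xs)))

packed⇒squarePacking : ∀ w → Packed w → SquarePacking (length w) (nth w)
packed⇒squarePacking w packed {q} q<N {p} p<q same = clockwise , anticlockwise
  where
  N = length w
  c = nth w p

  -- the first occurrence at p sees q at offset q - p - 1 when reading forward
  clockwise : p + 2 * c < q
  clockwise with m≤n⇒∃[o]m+o≡n p<q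
  ... | j , j≡ = ≰⇒> λ q≤p+2c →
    All-take-nth (2 * c) (rotation w p) (packed (<-trans p<q q<N))
      (+-cancelˡ-< p j (2 * c) (subst (_≤ p + 2 * c) (sym j≡) q≤p+2c)) j<rotation
      (trans (nth-++ˡ (drop (suc p) w) (take p w) j<drop)
        (trans (nth-drop (suc p) w j) (trans (cong (nth w) j≡) (sym same))))
    where
    j<drop : j < length (drop (suc p) w)
    j<drop = +-cancelˡ-< (suc p) j _
      (subst₂ _<_ (sym j≡) (length-split (suc p) w (≤-trans p<q (<⇒≤ q<N))) q<N)
    j<rotation : j < length (rotation w p)
    j<rotation = <-≤-trans j<drop (length-++-≤ˡ (drop (suc p) w))

  -- the second occurrence at q sees p after wrapping round past the end of w
  anticlockwise : q + 2 * c < N + p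
  anticlockwise = ≰⇒> λ N+p≤q+2c →
    All-take-nth (2 * nth w q) (rotation w q) (packed q<N) (index<2c N+p≤q+2c) index<rotation
      (trans (nth-++ʳ (drop (suc q) w) (take q w) p) (trans (nth-take q w p<q) same))
    where
    s = length (drop (suc q) w)
    N≡ : N ≡ suc q + s
    N≡ = length-split (suc q) w q<N
    index<2c : N + p ≤ q + 2 * c → s + p < 2 * nth w q
    index<2c N+p≤ = +-cancelˡ-< q (s + p) (2 * nth w q) (begin-strict
      q + (s + p)       <⟨ n<1+n _ ⟩
      suc q + (s + p)   ≡⟨ +-assoc (suc q) s p ⟨
      suc q + s + p     ≡⟨ cong (_+ p) N≡ ⟨
      N + p             ≤⟨ N+p≤ ⟩
      q + 2 * c         ≡⟨ cong (λ x → q + 2 * x) same ⟩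
      q + 2 * nth w q   ∎)
      where open ≤-Reasoning
    index<rotation : s + p < length (rotation w q)
    index<rotation = subst (s + p <_) (sym length-rotation) (+-monoʳ-< s p<q)
      where
      length-rotation : length (rotation w q) ≡ s + q
      length-rotation = trans (length-++ (drop (suc q) w))
        (cong (s +_) (trans (length-take q w) (m≤n⇒m⊓n≡m (<⇒≤ q<N))))

rotation-++ˡ : ∀ xs ys {i} → i < length xs → rotation (xs ++ ys) i ≡ (drop (suc i) xs ++ ys) ++ take i xs
rotation-++ˡ xs ys {i} i< = cong₂ _++_ (drop-++ˡ (suc i) xs ys i<) (take-++ˡ i xs ys (<⇒≤ i<))

rotation-++ʳ : ∀ xs ys j → rotation (xs ++ ys) (length xs + j) ≡ drop (suc j) ys ++ (xs ++ take j ys)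
rotation-++ʳ xs ys j = cong₂ _++_
  (trans (cong (λ k → drop k (xs ++ ys)) (sym (+-suc (length xs) j))) (drop-++ʳ xs ys (suc j)))
  (take-++ʳ xs ys j)

-- a packed window only looks 2c letters ahead, so it survives any change beyond them
packedAt-transfer : ∀ w i w′ i′ D X X′ → nth w i ≡ nth w′ i′ →
                    rotation w i ≡ D ++ X → rotation w′ i′ ≡ D ++ X′ →
                    2 * nth w i ≤ length D → PackedAt w i → PackedAt w′ i′
packedAt-transfer w i w′ i′ D X X′ same rot rot′ 2c≤ packedAt rewrite sym same =
  subst (All (_≢ nth w i)) window packedAt
  where
  open ≡-Reasoning
  window : take (2 * nth w i) (rotation w i) ≡ take (2 * nth w i) (rotation w′ i′)
  window = begin
    take (2 * nth w i) (rotation w i)    ≡⟨ cong (take _) rot ⟩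
    take (2 * nth w i) (D ++ X)          ≡⟨ take-++ˡ _ D X 2c≤ ⟩
    take (2 * nth w i) D                 ≡⟨ take-++ˡ _ D X′ 2c≤ ⟨
    take (2 * nth w i) (D ++ X′)         ≡⟨ cong (take _) rot′ ⟨
    take (2 * nth w i) (rotation w′ i′)  ∎

-- Periodic extension

split-index : ∀ {i} a {b} → i < a + b → i < a ⊎ ∃ λ j → i ≡ a + j × j < b
split-index {i} a i< with i <? a
... | yes i<a = inj₁ i<a
... | no  i≮a = let j , a+j≡i = m≤n⇒∃[o]m+o≡n (≮⇒≥ i≮a) in
  inj₂ (j , sym a+j≡i , +-cancelˡ-< a j _ (subst (_< a + _) (sym a+j≡i) i<))

module Period (P : List ℕ) {M : ℕ} (P-long : 2 * M ≤ length P) (P-packed : Packed (P ++ P)) where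

  private
    fits : ∀ {c} (xs ys : List ℕ) → c ≤ M → 2 * M ≤ length ys → 2 * c ≤ length (xs ++ ys)
    fits xs ys c≤M 2M≤ = ≤-trans (*-monoʳ-≤ 2 c≤M) (≤-trans 2M≤ (length-++-≤ʳ ys {xs}))

  module _ (Y : List ℕ) (small : All (_≤ M) (Y ++ P)) where
    private
      V W : List ℕ
      V = Y ++ P
      W = V ++ P

    packedAt-prefix : ∀ {i} → i < length Y → PackedAt V i → PackedAt W i
    packedAt-prefix {i} i<Y = packedAt-transfer V i W i D (take i Y) (P ++ take i Y)
      (sym (nth-++ˡ V P i<V)) (rotation-++ˡ Y P i<Y) rotation-W (fits (drop (suc i) Y) P (All-nth small i<V) P-long)
      where
      open ≡-Reasoning
      D = drop (suc i) Y ++ P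
      i<V : i < length V
      i<V = <-≤-trans i<Y (subst (length Y ≤_) (sym (length-++ Y)) (m≤m+n _ _))
      rotation-W : rotation W i ≡ D ++ (P ++ take i Y)
      rotation-W = begin
        rotation W i                          ≡⟨ rotation-++ˡ V P i<V ⟩
        (drop (suc i) V ++ P) ++ take i V     ≡⟨ cong₂ (λ u v → (u ++ P) ++ v) (drop-++ˡ (suc i) Y P i<Y)
                                                                           (take-++ˡ i Y P (<⇒≤ i<Y)) ⟩
        (D ++ P) ++ take i Y                  ≡⟨ ++-assoc D P (take i Y) ⟩
        D ++ (P ++ take i Y)                  ∎

    -- the first appended copy of P looks like the first half of P ++ P
    packedAt-middle : ∀ {j} → j < length P → PackedAt W (length Y + j)
    packedAt-middle {j} j<P = packedAt-transfer (P ++ P) j W (length Y + j) D (take j P) (Y ++ take j P)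
      (trans (nth-++ˡ P P j<P) (sym nth-W)) (rotation-++ˡ P P j<P) rotation-W
      (fits (drop (suc j) P) P (subst (_≤ M) (trans (nth-++ʳ Y P j) (sym (nth-++ˡ P P j<P))) (All-nth small j<V))
                               P-long)
      (P-packed (<-≤-trans j<P (subst (length P ≤_) (sym (length-++ P)) (m≤m+n _ _))))
      where
      open ≡-Reasoning
      D = drop (suc j) P ++ P
      j<V : length Y + j < length V
      j<V = subst (length Y + j <_) (sym (length-++ Y)) (+-monoʳ-< (length Y) j<P)
      nth-W : nth W (length Y + j) ≡ nth P j
      nth-W = begin
        nth W (length Y + j)              ≡⟨ cong (λ u → nth u (length Y + j)) (++-assoc Y P P) ⟩
        nth (Y ++ (P ++ P)) (length Y + j) ≡⟨ nth-++ʳ Y (P ++ P) j ⟩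
        nth (P ++ P) j                    ≡⟨ nth-++ˡ P P j<P ⟩
        nth P j                           ∎
      rotation-W : rotation W (length Y + j) ≡ D ++ (Y ++ take j P)
      rotation-W = begin
        rotation W (length Y + j)
          ≡⟨ cong (λ u → rotation u (length Y + j)) (++-assoc Y P P) ⟩
        rotation (Y ++ (P ++ P)) (length Y + j)
          ≡⟨ rotation-++ʳ Y (P ++ P) j ⟩
        drop (suc j) (P ++ P) ++ (Y ++ take j (P ++ P))
          ≡⟨ cong₂ (λ u v → u ++ (Y ++ v)) (drop-++ˡ (suc j) P P j<P) (take-++ˡ j P P (<⇒≤ j<P)) ⟩
        D ++ (Y ++ take j P)
          ∎

    packedAt-suffix : 2 * M ≤ length Y → ∀ {j} → j < length P →
                      PackedAt V (length Y + j) → PackedAt W (length V + j)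
    packedAt-suffix Y-long {j} j<P = packedAt-transfer V (length Y + j) W (length V + j) D (take j P) (P ++ take j P)
      (trans (nth-++ʳ Y P j) (sym (nth-++ʳ V P j)))
      (trans (rotation-++ʳ Y P j) (sym (++-assoc (drop (suc j) P) Y (take j P))))
      rotation-W (fits (drop (suc j) P) Y (All-nth small j<V) Y-long)
      where
      open ≡-Reasoning
      D = drop (suc j) P ++ Y
      j<V : length Y + j < length V
      j<V = subst (length Y + j <_) (sym (length-++ Y)) (+-monoʳ-< (length Y) j<P)
      rotation-W : rotation W (length V + j) ≡ D ++ (P ++ take j P)
      rotation-W = begin
        rotation W (length V + j)                  ≡⟨ rotation-++ʳ V P j ⟩
        drop (suc j) P ++ ((Y ++ P) ++ take j P)   ≡⟨ cong (drop (suc j) P ++_) (++-assoc Y P (take j P)) ⟩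
        drop (suc j) P ++ (Y ++ (P ++ take j P))   ≡⟨ ++-assoc (drop (suc j) P) Y (P ++ take j P) ⟨
        D ++ (P ++ take j P)                       ∎

  packed-++-period : ∀ Y → 2 * M ≤ length Y → All (_≤ M) (Y ++ P) →
                     Packed (Y ++ P) → Packed ((Y ++ P) ++ P)
  packed-++-period Y Y-long small packed {i} i<W
    with split-index (length (Y ++ P)) (subst (i <_) (length-++ (Y ++ P)) i<W)
  ... | inj₂ (j , refl , j<P) =
    packedAt-suffix Y small Y-long j<P (packed (subst (length Y + j <_) (sym (length-++ Y)) (+-monoʳ-< (length Y) j<P)))
  ... | inj₁ i<V with split-index (length Y) (subst (i <_) (length-++ Y) i<V)
  ...   | inj₁ i<Y              = packedAt-prefix Y small i<Y (packed i<V)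
  ...   | inj₂ (j , refl , j<P) = packedAt-middle Y small j<P

  withCopies : List ℕ → ℕ → List ℕ
  withCopies T = fold T (_++ P)

  length-withCopies : ∀ T q → length (withCopies T q) ≡ q * length P + length T
  length-withCopies T zero    = refl
  length-withCopies T (suc q) = begin
    length (withCopies T q ++ P)            ≡⟨ length-++ (withCopies T q) ⟩
    length (withCopies T q) + length P      ≡⟨ cong (_+ length P) (length-withCopies T q) ⟩
    q * length P + length T + length P      ≡⟨ shuffle (q * length P) (length T) (length P) ⟩
    length P + q * length P + length T      ∎
    where
    open ≡-Reasoning
    shuffle : ∀ a b c → a + b + c ≡ c + a + b
    shuffle = solve-∀

  All-withCopies : ∀ {Q : ℕ → Set} {T} → All Q T → All Q P → ∀ q → All Q (withCopies T q)
  All-withCopies QT QP zero    = QT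
  All-withCopies QT QP (suc q) = ++⁺ (All-withCopies QT QP q) QP

  packed-withCopies : ∀ T → 2 * M ≤ length T → All (_≤ M) T → All (_≤ M) P →
                      Packed T → Packed (T ++ P) → ∀ q → Packed (withCopies T q)
  packed-withCopies T T-long T-small P-small packed₀ packed₁ q = proj₁ (both q)
    where
    longer : ∀ q → length T ≤ length (withCopies T q)
    longer q = subst (length T ≤_) (sym (length-withCopies T q)) (m≤n+m _ _)
    both : ∀ q → Packed (withCopies T q) × Packed (withCopies T (suc q))
    both zero    = packed₀ , packed₁
    both (suc q) = let _ , packed = both q in
      packed , packed-++-period (withCopies T q) (≤-trans T-long (longer q))
                 (All-withCopies T-small P-small (suc q)) packed

-- Decidability

inRange? : ∀ k c → Dec (InRange k c)
inRange? k c = (1 ≤? c) ×-dec (c ≤? k)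

packed? : ∀ w → Dec (Packed w)
packed? w = allUpTo? (λ i → all? (λ y → ¬? (y ≟ nth w i)) _) (length w)

squarePacking? : ∀ N f → Dec (SquarePacking N f)
squarePacking? N f = allUpTo? (λ q → allUpTo? (λ p →
  (f p ≟ f q) →-dec ((p + 2 * f p <? q) ×-dec (q + 2 * f p <? N + p))) q) N

Word : ℕ → ℕ → (List ℕ → Set) → Set
Word k L Q = ∃ λ w → length w ≡ L × All (InRange k) w × Q w

word? : ∀ k L {Q : List ℕ → Set} → (∀ w → Dec (Q w)) → Dec (Word k L Q)
word? k zero    Q? = map′ (λ q → [] , refl , [] , q) (λ { ([] , _ , _ , q) → q }) (Q? [])
word? k (suc L) {Q} Q? = map′ cons uncons
  (anyUpTo? (λ c → inRange? k c ×-dec word? k L (Q? ∘ (c ∷_))) (suc k))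
  where
  cons : (∃ λ c → c < suc k × InRange k c × Word k L (Q ∘ (c ∷_))) → Word k (suc L) Q
  cons (c , _ , c∈ , w , len , w∈ , q) = c ∷ w , cong suc len , c∈ ∷ w∈ , q
  uncons : Word k (suc L) Q → ∃ λ c → c < suc k × InRange k c × Word k L (Q ∘ (c ∷_))
  uncons (c ∷ w , len , c∈@(_ , c≤k) ∷ w∈ , q) = c , s≤s c≤k , c∈ , w , suc-injective len , w∈ , q

nth-applyUpTo : ∀ f {N p} → p < N → nth (applyUpTo f N) p ≡ f p
nth-applyUpTo f {suc N} {zero}  _         = refl
nth-applyUpTo f {suc N} {suc p} (s≤s p<N) = nth-applyUpTo (f ∘ suc) p<N

All-applyUpTo : ∀ {Q : ℕ → Set} f N → (∀ {p} → p < N → Q (f p)) → All Q (applyUpTo f N)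
All-applyUpTo f zero    _  = []
All-applyUpTo f (suc N) Qf = Qf z<s ∷ All-applyUpTo (f ∘ suc) N (Qf ∘ s≤s)

squarePacking-cong : ∀ {N f g} → (∀ {p} → p < N → f p ≡ g p) → SquarePacking N f → SquarePacking N g
squarePacking-cong {f = f} {g} f≗g packing {q} q<N {p} p<q same
  rewrite sym (f≗g (<-trans p<q q<N)) | sym (f≗g q<N) = packing q<N p<q same

wordColouring : ∀ {k} w → All (InRange k) w → SquarePacking (length w) (nth w) →
                SquarePackingColouring (length w) k
wordColouring w w∈ packing = record { colour = nth w ; inRange = All-nth w∈ ; packing = packing }

squarePackingColouring? : ∀ N k → Dec (SquarePackingColouring N k)
squarePackingColouring? N k = map′ fromWord toWord (word? k N (λ w → squarePacking? N (nth w)))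
  where
  fromWord : Word k N (SquarePacking N ∘ nth) → SquarePackingColouring N k
  fromWord (w , refl , w∈ , packing) = wordColouring w w∈ packing
  toWord : SquarePackingColouring N k → Word k N (SquarePacking N ∘ nth)
  toWord χ = applyUpTo colour N , length-applyUpTo colour N , All-applyUpTo colour N inRange
           , squarePacking-cong (sym ∘ nth-applyUpTo colour) packing
    where open SquarePackingColouring χ

Least : (ℕ → Set) → ℕ → Set
Least P k = P k × (∀ j → P j → k ≤ j)

minimal : ∀ {P : ℕ → Set} → (∀ j → Dec (P j)) → ∀ {K} → P K → ∃ (Least P)
minimal {P} P? {K} = <-rec (λ K → P K → ∃ (Least P)) search K
  where
  search : ∀ K → (∀ {j} → j < K → P j → ∃ (Least P)) → P K → ∃ (Least P)
  search K below PK with anyUpTo? P? K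
  ... | yes (j , j<K , Pj) = below j<K Pj
  ... | no none = K , PK , λ j Pj → ≮⇒≥ λ j<K → none (j , j<K , Pj)

-- The total graph of a cycle

⌈/2⌉-≤ : ∀ {d c} → d ≤ 2 * c → ⌈ d /2⌉ ≤ c
⌈/2⌉-≤ {d} {c} d≤2c = begin
  ⌈ d /2⌉          ≤⟨ ⌈n/2⌉-mono d≤2c ⟩
  ⌈ 2 * c /2⌉      ≡⟨ cong ⌈_/2⌉ (cong (c +_) (+-identityʳ c)) ⟩
  ⌈ c + c /2⌉      ≡⟨ n≡⌈n+n/2⌉ c ⟨
  c                ∎
  where open ≤-Reasoning

open Edge

module _ {n : ℕ} {G : Graph n} where

  data Joins (e : Edge G) (a b : Fin n) : Set where
    forward  : end₁ e ≡ a → end₂ e ≡ b → Joins e a b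
    backward : end₁ e ≡ b → end₂ e ≡ a → Joins e a b

  joins-unique : ∀ {e f a b} → Joins e a b → Joins f a b → e ≡ f
  joins-unique {edge _ _ o _} {edge _ _ o′ _} (forward refl refl) (forward refl refl) = refl
  joins-unique {edge _ _ o _} {edge _ _ o′ _} (backward refl refl) (backward refl refl) = refl
  joins-unique {edge a b o _} {edge _ _ o′ _} (forward refl refl) (backward refl refl) =
    ⊥-elim (<-asym (recompute (_ <? _) o) (recompute (_ <? _) o′))
  joins-unique {edge a b o _} {edge _ _ o′ _} (backward refl refl) (forward refl refl) =
    ⊥-elim (<-asym (recompute (_ <? _) o) (recompute (_ <? _) o′))

  joins-same-ends : ∀ {e a a′ b b′} → Joins e a a′ → Joins e b b′ →
                    (a ≡ b × a′ ≡ b′) ⊎ (a ≡ b′ × a′ ≡ b)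
  joins-same-ends (forward p q) (forward p′ q′) = inj₁ (trans (sym p) p′ , trans (sym q) q′)
  joins-same-ends (forward p q) (backward p′ q′) = inj₂ (trans (sym p) p′ , trans (sym q) q′)
  joins-same-ends (backward p q) (forward p′ q′) = inj₂ (trans (sym q) q′ , trans (sym p) p′)
  joins-same-ends (backward p q) (backward p′ q′) = inj₁ (trans (sym q) q′ , trans (sym p) p′)

  joins-incident : ∀ {e a b u} → Joins e a b → Incident G u e → u ≡ a ⊎ u ≡ b
  joins-incident (forward refl refl) (inj₁ refl) = inj₁ refl
  joins-incident (forward refl refl) (inj₂ refl) = inj₂ refl
  joins-incident (backward refl refl) (inj₁ refl) = inj₂ refl
  joins-incident (backward refl refl) (inj₂ refl) = inj₁ refl

  joins-incidentˡ : ∀ {e a b} → Joins e a b → Incident G a e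
  joins-incidentˡ (forward refl _) = inj₁ refl
  joins-incidentˡ (backward _ refl) = inj₂ refl

  joins-incidentʳ : ∀ {e a b} → Joins e a b → Incident G b e
  joins-incidentʳ (forward _ refl) = inj₂ refl
  joins-incidentʳ (backward refl _) = inj₁ refl


module TotalGraphOfCycle (m : ℕ) (2≤m : 2 ≤ m) where

  n : ℕ
  n = suc m

  G : Graph n
  G = Cycle n

  fin : ℕ → Fin n
  fin i = fromℕ< (m%n<n i n)

  fin-≋ : ∀ i → toℕ (fin i) ≋ i mod n
  fin-≋ i = subst (_≋ i mod n) (sym (toℕ-fromℕ< (m%n<n i n))) (≋-sym (≋-% i))

  fin-cong : ∀ {i j} → i ≋ j mod n → fin i ≡ fin j
  fin-cong {i} {j} i≋j = toℕ-injective (≋-residues⇒≡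
    (≋-trans (fin-≋ i) (≋-trans i≋j (≋-sym (fin-≋ j)))) (toℕ<n (fin i)) (toℕ<n (fin j)))

  toℕ-fin : ∀ {i} → i < n → toℕ (fin i) ≡ i
  toℕ-fin {i} i<n = trans (toℕ-fromℕ< (m%n<n i n)) (m<n⇒m%n≡m i<n)

  next : Fin n → Fin n
  next t = fin (suc (toℕ t))

  next-fin : ∀ i → next (fin i) ≡ fin (suc i)
  next-fin i = fin-cong (≋-suc (fin-≋ i))

  adj⇒next : ∀ {a b} → T (cycleAdj n a b) → b ≡ next a
  adj⇒next {a} adj = toℕ-injective (trans (sym (toWitness adj)) (sym (toℕ-fromℕ< (m%n<n (suc (toℕ a)) n))))

  adj-next : ∀ a → T (cycleAdj n a (next a))
  adj-next a = fromWitness (sym (toℕ-fromℕ< (m%n<n (suc (toℕ a)) n)))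

  adjacent-next : ∀ a → T (cycleAdj n a (next a) ∨ cycleAdj n (next a) a)
  adjacent-next a = Equivalence.from T-∨ (inj₁ (adj-next a))

  private
    no-shift : ∀ (t : Fin n) d → 0 < d → d < n → toℕ t ≋ d + toℕ t mod n → ⊥
    no-shift t d 0<d d<n t≋ = ¬≋-shift (toℕ t) 0<d d<n (≋-sym t≋)

  next-≢ : ∀ t → t ≢ next t
  next-≢ t t≡ = no-shift t 1 z<s (s≤s (≤-trans (s≤s z≤n) 2≤m))
    (subst (λ u → toℕ u ≋ suc (toℕ t) mod n) (sym t≡) (fin-≋ (suc (toℕ t))))

  next²-≢ : ∀ t → t ≢ next (next t)
  next²-≢ t t≡ = no-shift t 2 z<s (s≤s 2≤m)
    (subst (λ u → toℕ u ≋ 2 + toℕ t mod n) (sym t≡) (≋-trans (fin-≋ _) (≋-suc (fin-≋ _))))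

  edgeAt : Fin n → Edge G
  edgeAt t with <-cmp (toℕ t) (toℕ (next t))
  ... | tri< lt _ _ = edge t (next t) lt (adjacent-next t)
  ... | tri≈ _ eq _ = ⊥-elim (next-≢ t (toℕ-injective eq))
  ... | tri> _ _ gt = edge (next t) t gt (Equivalence.from T-∨ (inj₂ (adj-next t)))

  edgeAt-joins : ∀ t → Joins (edgeAt t) t (next t)
  edgeAt-joins t with <-cmp (toℕ t) (toℕ (next t))
  ... | tri< _ _ _ = forward refl refl
  ... | tri≈ _ eq _ = ⊥-elim (next-≢ t (toℕ-injective eq))
  ... | tri> _ _ _ = backward refl refl

  -- every edge is {t, next t} for a unique t, its origin
  origin : Edge G → Fin n
  origin e = if cycleAdj n (end₁ e) (end₂ e) then end₁ e else end₂ e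

  origin-joins : ∀ e → Joins e (origin e) (next (origin e))
  origin-joins e@(edge a b _ isEdge) = orient (cycleAdj n a b) refl
    where
    orient : ∀ w → cycleAdj n a b ≡ w → let o = if w then a else b in Joins e o (next o)
    orient true  adj  = forward refl (adj⇒next (subst T (sym adj) _))
    orient false nadj =
      backward (adj⇒next (recompute (T? _) (subst (λ w → T (w ∨ cycleAdj n b a)) nadj isEdge))) refl

  joins-next-unique : ∀ {e : Edge G} {a b} → Joins e a (next a) → Joins e b (next b) → a ≡ b
  joins-next-unique ea eb with joins-same-ends {G = G} ea eb
  ... | inj₁ (a≡b , _) = a≡b
  ... | inj₂ (a≡b′ , a′≡b) = ⊥-elim (next²-≢ _ (trans (sym a′≡b) (cong next a≡b′)))

  origin-edgeAt : ∀ t → origin (edgeAt t) ≡ t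
  origin-edgeAt t = joins-next-unique (origin-joins (edgeAt t)) (edgeAt-joins t)

  origin-injective : ∀ {e f : Edge G} → origin e ≡ origin f → e ≡ f
  origin-injective {e} {f} eq =
    joins-unique {G = G} (origin-joins e) (subst (λ t → Joins f t (next t)) (sym eq) (origin-joins f))

  N : ℕ
  N = 2 * n

  position : TElem G → ℕ
  position (inj₁ u) = 2 * toℕ u
  position (inj₂ e) = suc (2 * toℕ (origin e))

  position-injective : ∀ {A B} → position A ≡ position B → A ≡ B
  position-injective {inj₁ u} {inj₁ v} eq = cong inj₁ (toℕ-injective (*-cancelˡ-≡ _ _ 2 eq))
  position-injective {inj₁ u} {inj₂ f} eq = ⊥-elim (even≢odd (toℕ u) (toℕ (origin f)) eq)
  position-injective {inj₂ e} {inj₁ v} eq = ⊥-elim (even≢odd (toℕ v) (toℕ (origin e)) (sym eq))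
  position-injective {inj₂ e} {inj₂ f} eq =
    cong inj₂ (origin-injective (toℕ-injective (*-cancelˡ-≡ _ _ 2 (suc-injective eq))))

  position<N : ∀ A → position A < N
  position<N (inj₁ u) = *-monoʳ-< 2 (toℕ<n u)
  position<N (inj₂ e) = subst (_≤ N) (*-suc 2 (toℕ (origin e))) (*-monoʳ-≤ 2 (toℕ<n (origin e)))

  -- elementAt p i is the element at position 2i + p
  elementAt : ℕ → ℕ → TElem G
  elementAt zero          i = inj₁ (fin i)
  elementAt (suc zero)    i = inj₂ (edgeAt (fin i))
  elementAt (suc (suc p)) i = elementAt p (suc i)

  element : ℕ → TElem G
  element p = elementAt p 0

  elementAt-step : ∀ p i → TAdj G (elementAt p i) (elementAt (suc p) i)
  elementAt-step zero          i = joins-incidentˡ (edgeAt-joins (fin i))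
  elementAt-step (suc zero)    i =
    subst (λ u → Incident G u (edgeAt (fin i))) (next-fin i) (joins-incidentʳ (edgeAt-joins (fin i)))
  elementAt-step (suc (suc p)) i = elementAt-step p (suc i)

  private
    sameEdge⇒≡ : ∀ {e f : Edge G} → SameEdge G e f → e ≡ f
    sameEdge⇒≡ {edge _ _ _ _} {edge _ _ _ _} (refl , refl) = refl

    shared⇒shareEnd : ∀ {u} {e f : Edge G} → Incident G u e → Incident G u f → ShareEnd G e f
    shared⇒shareEnd (inj₁ refl) u∈f = inj₁ u∈f
    shared⇒shareEnd (inj₂ refl) u∈f = inj₂ u∈f

  consecutive-edges : ∀ t → TAdj G (inj₂ (edgeAt t)) (inj₂ (edgeAt (next t)))
  consecutive-edges t = distinct ,
    shared⇒shareEnd {next t} {edgeAt t} {edgeAt (next t)}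
      (joins-incidentʳ (edgeAt-joins t)) (joins-incidentˡ (edgeAt-joins (next t)))
    where
    distinct : ¬ SameEdge G (edgeAt t) (edgeAt (next t))
    distinct same = next-≢ t (begin
      t                       ≡⟨ origin-edgeAt t ⟨
      origin (edgeAt t)       ≡⟨ cong origin (sameEdge⇒≡ {edgeAt t} {edgeAt (next t)} same) ⟩
      origin (edgeAt (next t)) ≡⟨ origin-edgeAt (next t) ⟩
      next t                  ∎)
      where open ≡-Reasoning

  elementAt-skip : ∀ p i → TAdj G (elementAt p i) (elementAt (suc (suc p)) i)
  elementAt-skip zero          i =
    subst (λ u → Adj G (fin i) u) (next-fin i) (next-≢ (fin i) , adjacent-next (fin i))
  elementAt-skip (suc zero)    i =
    subst (λ u → TAdj G (inj₂ (edgeAt (fin i))) (inj₂ (edgeAt u))) (next-fin i) (consecutive-edges (fin i))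
  elementAt-skip (suc (suc p)) i = elementAt-skip p (suc i)

  walk : ∀ d p → TWalk G (element p) (element (d + p)) ⌈ d /2⌉
  walk zero          p = here
  walk (suc zero)    p = step (elementAt-step p 0) here
  walk (suc (suc d)) p = step (elementAt-skip p 0)
    (subst (λ q → TWalk G (element (suc (suc p))) (element q) ⌈ d /2⌉)
           (trans (+-suc d (suc p)) (cong suc (+-suc d p))) (walk d (suc (suc p))))

  elementAt-shift : ∀ k p i → elementAt (2 * k + p) i ≡ elementAt p (k + i)
  elementAt-shift zero    p i = refl
  elementAt-shift (suc k) p i = begin
    elementAt (2 * suc k + p) i    ≡⟨ cong (λ q → elementAt (q + p) i) (*-suc 2 k) ⟩
    elementAt (2 * k + p) (suc i)  ≡⟨ elementAt-shift k p (suc i) ⟩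
    elementAt p (k + suc i)        ≡⟨ cong (elementAt p) (+-suc k i) ⟩
    elementAt p (suc k + i)        ∎
    where open ≡-Reasoning

  elementAt-periodic : ∀ p i → elementAt p (n + i) ≡ elementAt p i
  elementAt-periodic zero          i = cong inj₁ (fin-cong (≋-period i))
  elementAt-periodic (suc zero)    i = cong (λ t → inj₂ (edgeAt t)) (fin-cong (≋-period i))
  elementAt-periodic (suc (suc p)) i = trans (cong (elementAt p) (sym (+-suc n i))) (elementAt-periodic p (suc i))

  element-periodic : ∀ p → element (N + p) ≡ element p
  element-periodic p = trans (elementAt-shift n p 0) (elementAt-periodic p 0)

  position-elementAt : ∀ p i → 2 * i + p < N → position (elementAt p i) ≡ 2 * i + p
  position-elementAt zero i lt = begin
    2 * toℕ (fin i)  ≡⟨ cong (2 *_) (toℕ-fin (*-cancelˡ-< 2 i n (≤-trans (m≤m+n _ 0) lt))) ⟩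
    2 * i            ≡⟨ +-identityʳ (2 * i) ⟨
    2 * i + 0        ∎
    where open ≡-Reasoning
  position-elementAt (suc zero) i lt = begin
    suc (2 * toℕ (origin (edgeAt (fin i))))  ≡⟨ cong (λ t → suc (2 * toℕ t)) (origin-edgeAt (fin i)) ⟩
    suc (2 * toℕ (fin i))
      ≡⟨ cong (λ x → suc (2 * x)) (toℕ-fin (*-cancelˡ-< 2 i n (≤-trans (m≤m+n _ 1) lt))) ⟩
    suc (2 * i)                              ≡⟨ +-comm 1 (2 * i) ⟩
    2 * i + 1                                ∎
    where open ≡-Reasoning
  position-elementAt (suc (suc p)) i lt =
    trans (position-elementAt p (suc i) (subst (_< N) (shift i p) lt)) (sym (shift i p))
    where
    shift : ∀ a b → 2 * a + suc (suc b) ≡ 2 * suc a + b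
    shift = solve-∀

  position-element : ∀ {p} → p < N → position (element p) ≡ p
  position-element {p} = position-elementAt p 0

  private
    two-more : ∀ t → 2 * toℕ t + 2 ≋ position (inj₁ (next t)) mod N
    two-more t = ≋-trans (≡⇒≋ (trans (+-comm (2 * toℕ t) 2) (sym (*-suc 2 (toℕ t)))))
                           (≋-*ˡ 2 (≋-sym (fin-≋ (suc (toℕ t)))))

  next-within : ∀ t → Within N 2 (position (inj₁ t)) (position (inj₁ (next t)))
  next-within t = within 2 ≤-refl (inj₁ (two-more t))

  incident-within : ∀ {u} {e : Edge G} → Incident G u e → Within N 1 (position (inj₁ u)) (position (inj₂ e))
  incident-within {u} {e} u∈e with joins-incident (origin-joins e) u∈e
  ... | inj₁ refl = within 1 ≤-refl (inj₁ (≡⇒≋ (+-comm (2 * toℕ u) 1)))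
  ... | inj₂ refl =
    within 1 ≤-refl (inj₂ (≋-trans (≡⇒≋ (sym (+-suc (2 * toℕ (origin e)) 1))) (two-more (origin e))))

  adjacent-within : ∀ {A C} → TAdj G A C → Within N 2 (position A) (position C)
  adjacent-within {inj₁ u} {inj₁ v} (_ , adj) with Equivalence.to (T-∨ {cycleAdj n u v} {cycleAdj n v u}) adj
  ... | inj₁ uv = subst (λ w → Within N 2 (position (inj₁ u)) (position (inj₁ w))) (sym (adj⇒next uv))
                        (next-within u)
  ... | inj₂ vu = subst (λ w → Within N 2 (position (inj₁ w)) (position (inj₁ v))) (sym (adj⇒next vu))
                        (within-sym (next-within v))
  adjacent-within {inj₁ u} {inj₂ e} u∈e = within-weaken (s≤s z≤n) (incident-within {e = e} u∈e)
  adjacent-within {inj₂ e} {inj₁ u} u∈e = within-sym (within-weaken (s≤s z≤n) (incident-within {e = e} u∈e))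
  adjacent-within {inj₂ e} {inj₂ f} (_ , inj₁ shared) =
    within-trans (within-sym (incident-within {e = e} (inj₁ refl))) (incident-within {e = f} shared)
  adjacent-within {inj₂ e} {inj₂ f} (_ , inj₂ shared) =
    within-trans (within-sym (incident-within {e = e} (inj₂ refl))) (incident-within {e = f} shared)

  walk-within : ∀ {A B k} → TWalk G A B k → Within N (2 * k) (position A) (position B)
  walk-within {A} here = within-refl (position A)
  walk-within {A} {B} {suc k} (step adj w) =
    subst (λ r → Within N r (position A) (position B)) (sym (*-suc 2 k))
      (within-trans (adjacent-within adj) (walk-within w))

  squarePacking⇒totalPacking : ∀ {k} → SquarePackingColouring N k → PackingTotalColoring G k
  squarePacking⇒totalPacking {k} χ = record
    { col     = λ A → colour (position A)
    ; col≥1   = λ A → proj₁ (inRange (position<N A))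
    ; col≤k   = λ A → proj₂ (inRange (position<N A))
    ; packing = λ A B A≢B same j j≤c w →
        <⇒≱ (squarePacking-far packing (position<N A) (position<N B) (A≢B ∘ position-injective) same
                               (walk-within w))
            (*-monoʳ-≤ 2 j≤c)
    }
    where
    open SquarePackingColouring χ

  totalPacking⇒squarePacking : ∀ {k} → PackingTotalColoring G k → SquarePackingColouring N k
  totalPacking⇒squarePacking {k} χ = record
    { colour  = col ∘ element
    ; inRange = λ {p} _ → col≥1 (element p) , col≤k (element p)
    ; packing = λ {q} q<N {p} p<q same → separated p<q q<N same
    }
    where
    open PackingTotalColoring χ

    element-injective : ∀ {p q} → p < N → q < N → element p ≡ element q → p ≡ q
    element-injective {p} {q} p<N q<N eq =
      trans (sym (position-element p<N)) (trans (cong position eq) (position-element q<N))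

    -- a walk of d ≤ 2c positions has length ⌈d/2⌉ ≤ c, too short between two elements of colour c
    no-short-hop : ∀ {a B} → element a ≢ B → col (element a) ≡ col B →
                   ∀ d → d ≤ 2 * col (element a) → element (d + a) ≡ B → ⊥
    no-short-hop {a} a≢B same d d≤2c reach =
      packing _ _ a≢B same ⌈ d /2⌉ (⌈/2⌉-≤ d≤2c)
              (subst (λ B → TWalk G (element a) B ⌈ d /2⌉) reach (walk d a))

    separated : ∀ {p q} → p < q → q < N → col (element p) ≡ col (element q) →
                p + 2 * col (element p) < q × q + 2 * col (element p) < N + p
    separated {p} {q} p<q q<N same = clockwise , anticlockwise
      where
      p≢q : element p ≢ element q
      p≢q eq = <⇒≢ p<q (element-injective (<-trans p<q q<N) q<N eq)

      clockwise : p + 2 * col (element p) < q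
      clockwise = ≰⇒> λ q≤ →
        no-short-hop p≢q same (q ∸ p) (m≤n+o⇒m∸n≤o q p q≤) (cong element (m∸n+n≡m (<⇒≤ p<q)))

      anticlockwise : q + 2 * col (element p) < N + p
      anticlockwise = ≰⇒> λ N+p≤ → no-short-hop (p≢q ∘ sym) (sym same) (N + p ∸ q)
        (subst (λ c → N + p ∸ q ≤ 2 * c) same (m≤n+o⇒m∸n≤o (N + p) q N+p≤))
        (trans (cong element (m∸n+n≡m (≤-trans (<⇒≤ q<N) (m≤m+n N p)))) (element-periodic p))

  chromaticNumber-exact : ∀ {k} → SquarePackingColouring N k →
                          (∀ {j} → j < k → ¬ SquarePackingColouring N j) →
                          PackingTotalChromaticNumber G k
  chromaticNumber-exact χ fewer = squarePacking⇒totalPacking χ ,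
    λ j χ′ → ≮⇒≥ λ j<k → fewer j<k (totalPacking⇒squarePacking χ′)

  colourable? : ∀ j → Dec (PackingTotalColoring G j)
  colourable? j = map′ squarePacking⇒totalPacking totalPacking⇒squarePacking (squarePackingColouring? N j)

  chromaticNumber-exists : ∀ {K} → SquarePackingColouring N K →
                           ∃ λ k → PackingTotalChromaticNumber G k × k ≤ K
  chromaticNumber-exists χ with minimal colourable? (squarePacking⇒totalPacking χ)
  ... | k , χₖ , least = k , (χₖ , least) , least _ (squarePacking⇒totalPacking χ)

  chromaticNumber-word : ∀ {k} w → length w ≡ N → All (InRange k) w → Packed w → capacity N (pred k) < N →
                         PackingTotalChromaticNumber G k
  chromaticNumber-word {k} w len w∈ packed cap<N =
    chromaticNumber-exact (subst (λ L → SquarePackingColouring L k) len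
                                 (wordColouring w w∈ (packed⇒squarePacking w packed)))
      (λ j<k → capacity-exceeded cap<N (pred-mono-≤ j<k))

-- Explicit colourings

smallWord : ℕ → List ℕ
smallWord 3  = 1 ∷ 2 ∷ 3 ∷ 1 ∷ 4 ∷ 5 ∷ []
smallWord 4  = 1 ∷ 2 ∷ 3 ∷ 1 ∷ 4 ∷ 5 ∷ 6 ∷ 7 ∷ []
smallWord 5  = 1 ∷ 2 ∷ 3 ∷ 1 ∷ 4 ∷ 5 ∷ 2 ∷ 1 ∷ 6 ∷ 7 ∷ []
smallWord 6  = 1 ∷ 2 ∷ 3 ∷ 1 ∷ 4 ∷ 5 ∷ 1 ∷ 2 ∷ 6 ∷ 1 ∷ 7 ∷ 8 ∷ []
smallWord 7  = 1 ∷ 2 ∷ 3 ∷ 1 ∷ 4 ∷ 5 ∷ 1 ∷ 2 ∷ 6 ∷ 3 ∷ 1 ∷ 7 ∷ 8 ∷ 9 ∷ []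
smallWord 8  = 1 ∷ 2 ∷ 3 ∷ 1 ∷ 4 ∷ 5 ∷ 1 ∷ 2 ∷ 6 ∷ 1 ∷ 3 ∷ 7 ∷ 2 ∷ 1 ∷ 8 ∷ 9 ∷ []
smallWord 9  = 1 ∷ 2 ∷ 3 ∷ 1 ∷ 4 ∷ 5 ∷ 1 ∷ 2 ∷ 6 ∷ 1 ∷ 3 ∷ 7 ∷ 1 ∷ 4 ∷ 2 ∷ 1 ∷ 8 ∷ 9 ∷ []
smallWord 10 = 1 ∷ 2 ∷ 3 ∷ 1 ∷ 4 ∷ 5 ∷ 2 ∷ 1 ∷ 6 ∷ 3 ∷ 1 ∷ 2 ∷ 7 ∷ 1 ∷ 4 ∷ 8 ∷ 2 ∷ 1 ∷ 9 ∷ 10 ∷ []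
smallWord 11 = 1 ∷ 2 ∷ 3 ∷ 1 ∷ 4 ∷ 5 ∷ 1 ∷ 2 ∷ 6 ∷ 1 ∷ 3 ∷ 7 ∷ 1 ∷ 2 ∷ 4 ∷ 1 ∷ 5 ∷ 3 ∷ 2 ∷ 1 ∷ 8 ∷ 9 ∷ []
smallWord 12 = 1 ∷ 2 ∷ 3 ∷ 1 ∷ 4 ∷ 5 ∷ 1 ∷ 2 ∷ 6 ∷ 1 ∷ 3 ∷ 7 ∷ 1 ∷ 2 ∷ 4 ∷ 1 ∷ 5 ∷ 3 ∷ 1 ∷ 2 ∷ 8 ∷ 1 ∷ 9 ∷ 10 ∷ []
smallWord _  = []

-- baseWord i followed by q copies of periodWord colours the square of C_{2n} for n = 13 + i + 12q
periodWord : List ℕ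
periodWord = 1 ∷ 2 ∷ 3 ∷ 1 ∷ 4 ∷ 5 ∷ 1 ∷ 2 ∷ 6 ∷ 1 ∷ 3 ∷ 7 ∷ 1 ∷ 2 ∷ 4 ∷ 1 ∷ 5 ∷ 3 ∷ 1 ∷ 2 ∷ 8 ∷ 1 ∷ 9 ∷ 10 ∷ []

baseWord : ℕ → List ℕ
baseWord 0  = 1 ∷ 2 ∷ 3 ∷ 1 ∷ 4 ∷ 5 ∷ 1 ∷ 2 ∷ 6 ∷ 1 ∷ 3 ∷ 7 ∷ 1 ∷ 2 ∷ 4 ∷ 1 ∷ 5 ∷ 3 ∷ 1 ∷ 2 ∷ 8 ∷ 6 ∷ 1 ∷ 9 ∷ 10 ∷ 11 ∷ []
baseWord 1  = 1 ∷ 2 ∷ 3 ∷ 1 ∷ 4 ∷ 5 ∷ 1 ∷ 2 ∷ 6 ∷ 1 ∷ 3 ∷ 7 ∷ 1 ∷ 2 ∷ 4 ∷ 1 ∷ 5 ∷ 3 ∷ 1 ∷ 2 ∷ 8 ∷ 1 ∷ 6 ∷ 4 ∷ 1 ∷ 9 ∷ 10 ∷ 11 ∷ []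
baseWord 2  = 1 ∷ 2 ∷ 3 ∷ 1 ∷ 4 ∷ 5 ∷ 1 ∷ 2 ∷ 6 ∷ 1 ∷ 3 ∷ 7 ∷ 1 ∷ 2 ∷ 4 ∷ 1 ∷ 5 ∷ 3 ∷ 1 ∷ 2 ∷ 8 ∷ 1 ∷ 6 ∷ 4 ∷ 1 ∷ 2 ∷ 7 ∷ 1 ∷ 9 ∷ 10 ∷ []
baseWord 3  = 1 ∷ 2 ∷ 3 ∷ 1 ∷ 4 ∷ 5 ∷ 1 ∷ 2 ∷ 6 ∷ 1 ∷ 3 ∷ 7 ∷ 1 ∷ 2 ∷ 4 ∷ 1 ∷ 5 ∷ 3 ∷ 1 ∷ 2 ∷ 8 ∷ 1 ∷ 6 ∷ 4 ∷ 1 ∷ 2 ∷ 3 ∷ 1 ∷ 7 ∷ 9 ∷ 10 ∷ 11 ∷ []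
baseWord 4  = 1 ∷ 2 ∷ 3 ∷ 1 ∷ 4 ∷ 5 ∷ 1 ∷ 2 ∷ 6 ∷ 1 ∷ 3 ∷ 7 ∷ 1 ∷ 2 ∷ 4 ∷ 1 ∷ 5 ∷ 3 ∷ 1 ∷ 2 ∷ 8 ∷ 1 ∷ 6 ∷ 4 ∷ 1 ∷ 2 ∷ 3 ∷ 1 ∷ 5 ∷ 7 ∷ 1 ∷ 9 ∷ 10 ∷ 11 ∷ []
baseWord 5  = 1 ∷ 2 ∷ 3 ∷ 1 ∷ 4 ∷ 5 ∷ 1 ∷ 2 ∷ 6 ∷ 1 ∷ 3 ∷ 7 ∷ 1 ∷ 2 ∷ 4 ∷ 1 ∷ 5 ∷ 3 ∷ 1 ∷ 2 ∷ 8 ∷ 1 ∷ 6 ∷ 4 ∷ 1 ∷ 2 ∷ 3 ∷ 1 ∷ 5 ∷ 7 ∷ 1 ∷ 2 ∷ 9 ∷ 1 ∷ 10 ∷ 11 ∷ []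
baseWord 6  = 1 ∷ 2 ∷ 3 ∷ 1 ∷ 4 ∷ 5 ∷ 1 ∷ 2 ∷ 6 ∷ 1 ∷ 3 ∷ 7 ∷ 1 ∷ 2 ∷ 4 ∷ 1 ∷ 5 ∷ 3 ∷ 1 ∷ 2 ∷ 8 ∷ 1 ∷ 6 ∷ 4 ∷ 1 ∷ 2 ∷ 3 ∷ 1 ∷ 5 ∷ 7 ∷ 1 ∷ 2 ∷ 4 ∷ 1 ∷ 9 ∷ 10 ∷ 11 ∷ 8 ∷ []
baseWord 7  = 1 ∷ 2 ∷ 3 ∷ 1 ∷ 4 ∷ 5 ∷ 1 ∷ 2 ∷ 6 ∷ 1 ∷ 3 ∷ 7 ∷ 1 ∷ 2 ∷ 4 ∷ 1 ∷ 5 ∷ 3 ∷ 1 ∷ 2 ∷ 8 ∷ 1 ∷ 6 ∷ 4 ∷ 1 ∷ 2 ∷ 3 ∷ 1 ∷ 5 ∷ 7 ∷ 1 ∷ 2 ∷ 4 ∷ 1 ∷ 3 ∷ 6 ∷ 1 ∷ 8 ∷ 9 ∷ 10 ∷ []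
baseWord 8  = 1 ∷ 2 ∷ 3 ∷ 1 ∷ 4 ∷ 5 ∷ 1 ∷ 2 ∷ 6 ∷ 1 ∷ 3 ∷ 7 ∷ 1 ∷ 2 ∷ 4 ∷ 1 ∷ 5 ∷ 3 ∷ 1 ∷ 2 ∷ 8 ∷ 1 ∷ 6 ∷ 4 ∷ 1 ∷ 2 ∷ 3 ∷ 1 ∷ 5 ∷ 7 ∷ 1 ∷ 2 ∷ 4 ∷ 1 ∷ 3 ∷ 6 ∷ 1 ∷ 2 ∷ 8 ∷ 1 ∷ 9 ∷ 10 ∷ []
baseWord 9  = 1 ∷ 2 ∷ 3 ∷ 1 ∷ 4 ∷ 5 ∷ 1 ∷ 2 ∷ 6 ∷ 1 ∷ 3 ∷ 7 ∷ 1 ∷ 2 ∷ 4 ∷ 1 ∷ 5 ∷ 3 ∷ 1 ∷ 2 ∷ 8 ∷ 1 ∷ 6 ∷ 4 ∷ 1 ∷ 2 ∷ 3 ∷ 1 ∷ 5 ∷ 7 ∷ 2 ∷ 1 ∷ 4 ∷ 3 ∷ 1 ∷ 2 ∷ 6 ∷ 1 ∷ 8 ∷ 9 ∷ 2 ∷ 1 ∷ 10 ∷ 11 ∷ []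
baseWord 10 = 1 ∷ 2 ∷ 3 ∷ 1 ∷ 4 ∷ 5 ∷ 1 ∷ 2 ∷ 6 ∷ 1 ∷ 3 ∷ 7 ∷ 1 ∷ 2 ∷ 4 ∷ 1 ∷ 5 ∷ 3 ∷ 1 ∷ 2 ∷ 8 ∷ 1 ∷ 6 ∷ 4 ∷ 1 ∷ 2 ∷ 3 ∷ 1 ∷ 5 ∷ 7 ∷ 1 ∷ 2 ∷ 4 ∷ 1 ∷ 3 ∷ 6 ∷ 1 ∷ 2 ∷ 8 ∷ 1 ∷ 5 ∷ 3 ∷ 1 ∷ 9 ∷ 10 ∷ 11 ∷ []
baseWord 11 = 1 ∷ 2 ∷ 3 ∷ 1 ∷ 4 ∷ 5 ∷ 1 ∷ 2 ∷ 6 ∷ 1 ∷ 3 ∷ 7 ∷ 1 ∷ 2 ∷ 4 ∷ 1 ∷ 5 ∷ 3 ∷ 1 ∷ 2 ∷ 8 ∷ 1 ∷ 6 ∷ 4 ∷ 1 ∷ 2 ∷ 3 ∷ 1 ∷ 5 ∷ 7 ∷ 1 ∷ 2 ∷ 4 ∷ 1 ∷ 3 ∷ 6 ∷ 1 ∷ 2 ∷ 8 ∷ 1 ∷ 5 ∷ 3 ∷ 1 ∷ 2 ∷ 7 ∷ 1 ∷ 9 ∷ 10 ∷ []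
baseWord _  = []

Base : ℕ → Set
Base i = length (baseWord i) ≡ 2 * (13 + i) × All (InRange 11) (baseWord i)
       × Packed (baseWord i) × Packed (baseWord i ++ periodWord)

bases : ∀ {i} → i < 12 → Base i
bases = toWitness {a? = allUpTo? (λ i → let w = baseWord i in
  (length w ≟ 2 * (13 + i)) ×-dec all? (inRange? 11) w ×-dec packed? w ×-dec packed? (w ++ periodWord))
  12} _

periodWord-inRange : All (InRange 11) periodWord
periodWord-inRange = toWitness {a? = all? (inRange? 11) periodWord} _

periodWord-packed : Packed (periodWord ++ periodWord)
periodWord-packed = toWitness {a? = packed? (periodWord ++ periodWord)} _

open Period periodWord {M = 11} (m≤m+n 22 2) periodWord-packed

-- the implicit certificates are decided by evaluation at each use
smallCycle : ∀ n k → {_ : True (3 ≤? n)} {_ : True (length (smallWord n) ≟ 2 * n)}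
             {_ : True (all? (inRange? k) (smallWord n))} {_ : True (packed? (smallWord n))}
             {_ : True (capacity (2 * n) (pred k) <? 2 * n)} →
             PackingTotalChromaticNumber (Cycle n) k
smallCycle (suc m) k {3≤n} {len} {w∈} {packed} {cap} =
  TotalGraphOfCycle.chromaticNumber-word m (s≤s⁻¹ (toWitness {a? = 3 ≤? suc m} 3≤n)) w
    (toWitness {a? = length w ≟ 2 * suc m} len) (toWitness {a? = all? (inRange? k) w} w∈)
    (toWitness {a? = packed? w} packed) (toWitness {a? = capacity (2 * suc m) (pred k) <? 2 * suc m} cap)
  where
  w = smallWord (suc m)

decompose : ∀ n → 13 ≤ n → ∃ λ i → ∃ λ q → i < 12 × n ≡ 13 + i + q * 12
decompose n 13≤n = r , q , m%n<n (n ∸ 13) 12 , (begin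
  n                      ≡⟨ m+[n∸m]≡n 13≤n ⟨
  13 + (n ∸ 13)          ≡⟨ cong (13 +_) (m≡m%n+[m/n]*n (n ∸ 13) 12) ⟩
  13 + (r + q * 12)      ≡⟨ +-assoc 13 r (q * 12) ⟨
  13 + r + q * 12        ∎)
  where
  open ≡-Reasoning
  r = (n ∸ 13) % 12
  q = (n ∸ 13) / 12

baseColouring : ∀ n i q → n ≡ 13 + i + q * 12 → Base i → SquarePackingColouring (2 * n) 11
baseColouring n i q n≡ (len , w∈ , packed₀ , packed₁) = subst (λ L → SquarePackingColouring L 11) length-w
  (wordColouring w (All-withCopies w∈ periodWord-inRange q)
    (packed⇒squarePacking w (packed-withCopies (baseWord i) long
      (All.map proj₂ w∈) (All.map proj₂ periodWord-inRange) packed₀ packed₁ q)))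
  where
  long : 22 ≤ length (baseWord i)
  long = ≤-trans (m≤m+n 22 4) (≤-trans (*-monoʳ-≤ 2 (m≤m+n 13 i)) (≤-reflexive (sym len)))
  w : List ℕ
  w = withCopies (baseWord i) q
  length-w : length w ≡ 2 * n
  length-w = begin
    length w                            ≡⟨ length-withCopies (baseWord i) q ⟩
    q * 24 + length (baseWord i)        ≡⟨ cong (q * 24 +_) len ⟩
    q * 24 + 2 * (13 + i)               ≡⟨ arrange q i ⟩
    2 * (13 + i + q * 12)               ≡⟨ cong (2 *_) n≡ ⟨
    2 * n                               ∎
    where
    open ≡-Reasoning
    arrange : ∀ q i → q * 24 + 2 * (13 + i) ≡ 2 * (13 + i + q * 12)
    arrange = solve-∀

largeCycle : ∀ n → 13 ≤ n → ∃ λ k → PackingTotalChromaticNumber (Cycle n) k × 7 ≤ k × k ≤ 11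
largeCycle n@(suc m) 13≤n =
  let i , q , i<12 , n≡ = decompose n 13≤n
      k , χₖ@(colouring , _) , k≤11 = chromaticNumber-exists (baseColouring n i q n≡ (bases i<12))
      7≤k = ≮⇒≥ λ k<7 →
        no-six-colouring 13≤2n (colouring-weaken (s≤s⁻¹ k<7) (totalPacking⇒squarePacking colouring))
  in  k , χₖ , 7≤k , k≤11
  where
  2≤m : 2 ≤ m
  2≤m = ≤-trans (s≤s (s≤s z≤n)) (s≤s⁻¹ 13≤n)
  13≤2n : 13 ≤ 2 * n
  13≤2n = ≤-trans 13≤n (m≤m+n n _)
  open TotalGraphOfCycle m 2≤m using (chromaticNumber-exists; totalPacking⇒squarePacking)

theorem3p2 :
    PackingTotalChromaticNumber (Cycle 3) 5
    × (∀ n → (n ≡ 4 ⊎ n ≡ 5) → PackingTotalChromaticNumber (Cycle n) 7)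
    × PackingTotalChromaticNumber (Cycle 6) 8
    × (∀ n → (n ≡ 7 ⊎ n ≡ 8 ⊎ n ≡ 9 ⊎ n ≡ 11) → PackingTotalChromaticNumber (Cycle n) 9)
    × (∀ n → (n ≡ 10 ⊎ n ≡ 12) → PackingTotalChromaticNumber (Cycle n) 10)
    × (∀ n → 13 ≤ n → Σ[ k ∈ ℕ ] (PackingTotalChromaticNumber (Cycle n) k × 7 ≤ k × k ≤ 11))
theorem3p2 = smallCycle 3 5 , seven , smallCycle 6 8 , nine , ten , largeCycle
  where
  seven : ∀ n → (n ≡ 4 ⊎ n ≡ 5) → PackingTotalChromaticNumber (Cycle n) 7
  seven n (inj₁ refl) = smallCycle 4 7
  seven n (inj₂ refl) = smallCycle 5 7
  nine : ∀ n → (n ≡ 7 ⊎ n ≡ 8 ⊎ n ≡ 9 ⊎ n ≡ 11) → PackingTotalChromaticNumber (Cycle n) 9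
  nine n (inj₁ refl)                 = smallCycle 7 9
  nine n (inj₂ (inj₁ refl))          = smallCycle 8 9
  nine n (inj₂ (inj₂ (inj₁ refl)))   = smallCycle 9 9
  nine n (inj₂ (inj₂ (inj₂ refl)))   = smallCycle 11 9
  ten : ∀ n → (n ≡ 10 ⊎ n ≡ 12) → PackingTotalChromaticNumber (Cycle n) 10
  ten n (inj₁ refl) = smallCycle 10 10
  ten n (inj₂ refl) = smallCycle 12 10
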